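{- Fix $n \geq 1$. Let $S_i \subseteq 2^{<\omega}$, $i<n$, be pairwise disjoint sets, each consisting of pairwise incomparable strings, with $|S_i|\geq n$ for each $i<n$. Then there is a set $\{\sigma_i : i<n\}$ of pairwise incomparable strings with $\sigma_i \in S_i$ for each $i<n$.
   Context: Strings $\sigma,\tau\in 2^{<\omega}$ are incomparable if neither is a prefix of the other. -}

module Defs where

open import Data.Bool using (Bool)
open import Data.List using (List)
open import Data.Fin using (Fin)
open import Data.Nat using (ℕ)
open import Data.Empty using (⊥)
open import Data.Sum using (_⊎_)
open import Data.Product using (Σ; _×_)
open import Relation.Nullary using (¬_)
open import Relation.Binary.PropositionalEquality using (_≡_)
open import Data.List.Relation.Binary.Prefix.Heterogeneous using (Prefix)
open import Function.Definitions using (Injective)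

Str : Set
Str = List Bool

_⊑_ : Str → Str → Set
σ ⊑ τ = Prefix _≡_ σ τ

Incomparable : Str → Str → Set
Incomparable σ τ = ¬ (σ ⊑ τ ⊎ τ ⊑ σ)

StrSet : Set₁
StrSet = Str → Set

AntiChain : StrSet → Set
AntiChain S = ∀ σ τ → S σ → S τ → ¬ (σ ≡ τ) → Incomparable σ τ

Disjoint : StrSet → StrSet → Set
Disjoint S T = ∀ σ → S σ → T σ → ⊥

CardGE : StrSet → ℕ → Set
CardGE S n = Σ (Fin n → Str) λ f → Injective _≡_ _≡_ f × (∀ k → S (f k))

{-# OPTIONS --safe #-}
module Submission where

-- Let s₀ ∈ S i₀ be a longest string among the n given members of each
-- S i. For j ≠ i₀ no given member of S j extends s₀: it would be no longer, hence equal
-- to s₀, against disjointness. So the given members of S j comparable with s₀ are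
-- prefixes of s₀, pairwise comparable, hence at most one, as S j is an antichain.
-- Discarding it leaves n − 1 members of each S j incomparable with s₀, and the
-- induction hypothesis for these n − 1 sets yields the remaining strings.

open import Defs
open import Data.Nat using (ℕ; _≥_; zero; suc; _≤_)
open import Data.Nat.Properties using (≤-trans; ≤-antisym)
open import Data.Fin using (Fin; punchIn; punchOut) renaming (zero to fzero; suc to fsuc)
open import Data.Fin.Properties
  using (suc-injective; punchIn-injective; punchInᵢ≢i; punchOut-injective; punchIn-punchOut; any?)
  renaming (_≟_ to _≟ᶠ_)
open import Data.Product using (Σ; _×_; _,_; proj₁; proj₂; ∃₂)
open import Data.Sum as Sum using (_⊎_; inj₁; inj₂)
open import Data.Empty using (⊥-elim)
open import Data.Bool.Properties using () renaming (_≟_ to _≟ᵇ_)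
open import Data.List using ([]; _∷_; length; allFin)
open import Data.List.Properties using (≡-dec)
open import Data.List.Relation.Unary.All as All using ()
open import Data.List.Membership.Propositional.Properties using (∈-allFin)
open import Data.List.Extrema.Nat using (argmax; f[xs]≤f[argmax])
open import Data.List.Relation.Binary.Pointwise using (Pointwise-≡⇒≡)
open import Data.List.Relation.Binary.Prefix.Heterogeneous using ([]; _∷_)
open import Data.List.Relation.Binary.Prefix.Heterogeneous.Properties
  using (length-mono; toPointwise; prefix?)
open import Function using (_∘_)
open import Function.Definitions using (Injective)
open import Relation.Nullary using (¬_; Dec; yes; no)
open import Relation.Nullary.Decidable using (¬?; _⊎-dec_; decidable-stable)
open import Relation.Unary using (Decidable; _∩_)
open import Relation.Binary.PropositionalEquality using (_≡_; _≢_; refl; sym; subst)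

⊑-comparable : ∀ {ρ σ τ} → ρ ⊑ τ → σ ⊑ τ → ρ ⊑ σ ⊎ σ ⊑ ρ
⊑-comparable []         _          = inj₁ []
⊑-comparable (_ ∷ _)    []         = inj₂ []
⊑-comparable (refl ∷ p) (refl ∷ q) = Sum.map (refl ∷_) (refl ∷_) (⊑-comparable p q)

⊑∧length≥⇒≡ : ∀ {σ τ} → σ ⊑ τ → length τ ≤ length σ → σ ≡ τ
⊑∧length≥⇒≡ σ⊑τ |τ|≤|σ| = Pointwise-≡⇒≡ (toPointwise (≤-antisym (length-mono σ⊑τ) |τ|≤|σ|) σ⊑τ)

comparable? : ∀ σ τ → Dec (σ ⊑ τ ⊎ τ ⊑ σ)
comparable? σ τ = prefix? _≟ᵇ_ σ τ ⊎-dec prefix? _≟ᵇ_ τ σ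

Incomparable-sym : ∀ {σ τ} → Incomparable σ τ → Incomparable τ σ
Incomparable-sym σ∥τ = σ∥τ ∘ Sum.swap

AntiChain-comparable⇒≡ : ∀ {S σ τ} → AntiChain S → S σ → S τ → σ ⊑ τ ⊎ τ ⊑ σ → σ ≡ τ
AntiChain-comparable⇒≡ {σ = σ} {τ} anti σ∈S τ∈S comparable =
  decidable-stable (≡-dec _≟ᵇ_ σ τ) (λ σ≢τ → anti σ τ σ∈S τ∈S σ≢τ comparable)

-- Opaque: unfolding argmax over allFin during conversion checking is prohibitively slow.
opaque
  argmaxᶠ : ∀ {m} (g : Fin (suc m) → ℕ) → Σ (Fin (suc m)) λ a → ∀ b → g b ≤ g a
  argmaxᶠ {m} g =
    argmax g fzero (allFin (suc m)) ,
    λ b → All.lookup (f[xs]≤f[argmax] {f = g} fzero (allFin (suc m))) (∈-allFin b)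

longest-entry : ∀ {m n} (F : Fin (suc m) → Fin (suc n) → Str) →
                ∃₂ λ i k → ∀ j l → length (F j l) ≤ length (F i k)
longest-entry {m} {n} F = i , k i , λ j l → ≤-trans (k-max j l) (i-max j)
  where
  k : Fin (suc m) → Fin (suc n)
  k j = proj₁ (argmaxᶠ (length ∘ F j))
  k-max : ∀ j l → length (F j l) ≤ length (F j (k j))
  k-max j = proj₂ (argmaxᶠ (length ∘ F j))
  i : Fin (suc m)
  i = proj₁ (argmaxᶠ (λ j → length (F j (k j))))
  i-max : ∀ j → length (F j (k j)) ≤ length (F i (k i))
  i-max = proj₂ (argmaxᶠ (λ j → length (F j (k j))))

CardGE-∩ : ∀ {m} {S P : StrSet} → Decidable P →
           (f : Fin (suc m) → Str) → Injective _≡_ _≡_ f → (∀ k → S (f k)) →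
           (∀ k l → ¬ P (f k) → ¬ P (f l) → k ≡ l) → CardGE (S ∩ P) m
CardGE-∩ P? f f-inj f∈S at-most-one with any? (λ k → ¬? (P? (f k)))
... | yes (k , ¬Pfk) =
  f ∘ punchIn k , (λ e → punchIn-injective k _ _ (f-inj e)) ,
  λ l → f∈S _ , decidable-stable (P? _) (λ ¬P → punchInᵢ≢i k l (at-most-one _ k ¬P ¬Pfk))
... | no all-P =
  f ∘ fsuc , suc-injective ∘ f-inj , λ l → f∈S _ , decidable-stable (P? _) (λ ¬P → all-P (_ , ¬P))

Transversal : ∀ {m} → (Fin m → StrSet) → Set
Transversal {m} S =
  Σ (Fin m → Str) λ σ → (∀ i → S i (σ i)) × (∀ i j → i ≢ j → Incomparable (σ i) (σ j))

Residual : ∀ {m} → (Fin (suc m) → StrSet) → Fin (suc m) → Str → Fin m → StrSet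
Residual S i₀ s₀ j = S (punchIn i₀ j) ∩ λ τ → Incomparable τ s₀

Transversal-insert : ∀ {m} (S : Fin (suc m) → StrSet) i₀ {s₀} → S i₀ s₀ →
                     Transversal (Residual S i₀ s₀) → Transversal S
Transversal-insert S i₀ {s₀} s₀∈S (ρ , ρ∈S , ρ-inc) = σ , σ∈S , σ-inc
  where
  σ : Fin _ → Str
  σ x with i₀ ≟ᶠ x
  ... | yes _   = s₀
  ... | no i₀≢x = ρ (punchOut i₀≢x)

  σ∈S : ∀ x → S x (σ x)
  σ∈S x with i₀ ≟ᶠ x
  ... | yes refl = s₀∈S
  ... | no i₀≢x  =
    subst (λ y → S y (ρ (punchOut i₀≢x))) (punchIn-punchOut i₀≢x) (proj₁ (ρ∈S (punchOut i₀≢x)))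

  σ-inc : ∀ x y → x ≢ y → Incomparable (σ x) (σ y)
  σ-inc x y x≢y with i₀ ≟ᶠ x | i₀ ≟ᶠ y
  ... | yes refl | yes refl = ⊥-elim (x≢y refl)
  ... | yes refl | no i₀≢y  = Incomparable-sym (proj₂ (ρ∈S (punchOut i₀≢y)))
  ... | no i₀≢x  | yes refl = proj₂ (ρ∈S (punchOut i₀≢x))
  ... | no i₀≢x  | no i₀≢y  = ρ-inc _ _ (x≢y ∘ punchOut-injective i₀≢x i₀≢y)

transversal : ∀ m (S : Fin m → StrSet) →
              (∀ i j → i ≢ j → Disjoint (S i) (S j)) → (∀ i → AntiChain (S i)) →
              (∀ i → CardGE (S i) m) → Transversal S
transversal zero    S disj anti card = (λ ()) , (λ ()) , λ ()
transversal (suc m) S disj anti card with longest-entry (proj₁ ∘ card)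
... | i₀ , k₀ , longest =
  Transversal-insert S i₀ (f∈S i₀ k₀) (transversal m (Residual S i₀ s₀) disj′ anti′ card′)
  where
  f : ∀ i → Fin (suc m) → Str
  f i = proj₁ (card i)
  f-inj : ∀ i → Injective _≡_ _≡_ (f i)
  f-inj i = proj₁ (proj₂ (card i))
  f∈S : ∀ i k → S i (f i k)
  f∈S i = proj₂ (proj₂ (card i))
  s₀ : Str
  s₀ = f i₀ k₀

  s₀-not-extended : ∀ j k → ¬ s₀ ⊑ f (punchIn i₀ j) k
  s₀-not-extended j k s₀⊑ =
    disj i₀ (punchIn i₀ j) (punchInᵢ≢i i₀ j ∘ sym) s₀ (f∈S i₀ k₀)
      (subst (S (punchIn i₀ j)) (sym (⊑∧length≥⇒≡ s₀⊑ (longest _ k))) (f∈S _ k))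

  comparable⇒⊑s₀ : ∀ j k → ¬ Incomparable (f (punchIn i₀ j) k) s₀ → f (punchIn i₀ j) k ⊑ s₀
  comparable⇒⊑s₀ j k ¬inc =
    Sum.fromInj₁ (⊥-elim ∘ s₀-not-extended j k) (decidable-stable (comparable? _ s₀) ¬inc)

  card′ : ∀ j → CardGE (Residual S i₀ s₀ j) m
  card′ j = CardGE-∩ {S = S i} (λ τ → ¬? (comparable? τ s₀)) (f i) (f-inj i) (f∈S i)
              λ k l ¬k ¬l → f-inj i (AntiChain-comparable⇒≡ (anti i) (f∈S i k) (f∈S i l)
                              (⊑-comparable (comparable⇒⊑s₀ j k ¬k) (comparable⇒⊑s₀ j l ¬l)))
    where i = punchIn i₀ j

  disj′ : ∀ i j → i ≢ j → Disjoint (Residual S i₀ s₀ i) (Residual S i₀ s₀ j)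
  disj′ i j i≢j τ (τ∈Si , _) (τ∈Sj , _) = disj _ _ (i≢j ∘ punchIn-injective i₀ i j) τ τ∈Si τ∈Sj

  anti′ : ∀ j → AntiChain (Residual S i₀ s₀ j)
  anti′ j σ τ (σ∈S , _) (τ∈S , _) = anti _ σ τ σ∈S τ∈S

lemma4p3 : (n : ℕ) → n ≥ 1 → (S : Fin n → StrSet) →
    (∀ i j → ¬ (i ≡ j) → Disjoint (S i) (S j)) →
    (∀ i → AntiChain (S i)) →
    (∀ i → CardGE (S i) n) →
    Σ (Fin n → Str) λ σ → (∀ i → S i (σ i)) × (∀ i j → ¬ (i ≡ j) → Incomparable (σ i) (σ j))
lemma4p3 n _ = transversal n
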